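{- For every nonnegative integer $n$, \[ \sum_{k=0}^{n}(-4)^k\frac{\binom{n}{k}}{\binom{2k}{k}}H_{2k} =\frac{2H_{2n}-H_n}{2(2n-1)}-\frac{4n}{(2n-1)^2}. \]
   Context: For a nonnegative integer $m$, the harmonic number $H_m$ is defined by $H_0=0$ and $H_m=\sum_{i=1}^m \frac{1}{i}$ for $m\ge 1$. -}

module Defs where

open import Data.Nat using (ℕ; zero; suc)
open import Data.Nat.Combinatorics using (_C_)
open import Data.Integer using (ℤ; +_)
open import Data.Rational using (ℚ; 0ℚ; 1ℚ; _+_; _*_; _-_; -_; 1/_; _/_; ≢-nonZero)
open import Data.Rational.Properties using (_≟_)
open import Relation.Nullary using (yes; no)

ℕ→ℚ : ℕ → ℚ
ℕ→ℚ n = (+ n) / 1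

-- total reciprocal: 1/p for p ≠ 0, and 0 at 0 (only ever applied to nonzero values below)
inv : ℚ → ℚ
inv p with p ≟ 0ℚ
... | yes _ = 0ℚ
... | no p≢0 = 1/_ p {{≢-nonZero p≢0}}

_div_ : ℚ → ℚ → ℚ
p div q = p * inv q

H : ℕ → ℚ
H zero = 0ℚ
H (suc m) = H m + inv (ℕ→ℚ (suc m))

pow : ℚ → ℕ → ℚ
pow x zero = 1ℚ
pow x (suc k) = x * pow x k

Σ0to : ℕ → (ℕ → ℚ) → ℚ
Σ0to zero f = f zero
Σ0to (suc n) f = Σ0to n f + f (suc n)

LHS : ℕ → ℚ
LHS n = Σ0to n (λ k → pow (- ℕ→ℚ 4) k * (ℕ→ℚ (n C k) div ℕ→ℚ ((2 Data.Nat.* k) C k)) * H (2 Data.Nat.* k))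

-- 2n - 1 as a rational (equals -1 at n = 0)
twoNm1 : ℕ → ℚ
twoNm1 n = ℕ→ℚ (2 Data.Nat.* n) - 1ℚ

RHS : ℕ → ℚ
RHS n = ((ℕ→ℚ 2 * H (2 Data.Nat.* n) - H n) div (ℕ→ℚ 2 * twoNm1 n))
      - (ℕ→ℚ (4 Data.Nat.* n) div (twoNm1 n * twoNm1 n))

-- For n : ℕ write c(n,k) = (-4)^k C(n,k)/C(2k,k), so that the theorem reads
--   F(n) := Σ_{k≤n} c(n,k) H_{2k} = (2H_{2n} - H_n)/(2(2n-1)) - 4n/(2n-1)².
-- Two recurrences drive the proof (coeff-step, coeff-pascal):
--   (2k+1) c(n,k+1)   = -2(n-k) c(n,k)                        (central ratio and absorption),
--   (2k+1) c(n+1,k+1) = (2k+1) c(n,k+1) - 2(k+1) c(n,k)       (Pascal's rule).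
-- The first makes three sums telescope, because c(n,n+1) = 0:
--   (2n-1) Σ_k c(n,k) = -1,    Σ_k c(n,k)/(2k+1) = 1/(2n+1),
--   2(2n-1) F(n) - 4 Σ_k c(n,k) + R(n) = -4,   where R(n) = Σ_{k≥1} c(n,k)/k.
-- The second, together with the middle sum, gives R(n+1) = R(n) - 2/(2n+1), so by induction
-- R(n) = H_n - 2H_{2n}.  Solving the last telescoped identity for F(n) proves the theorem.
module Submission where

open import Defs
open import Data.Nat as ℕ using (ℕ; zero; suc; z≤n; s≤s)
import Data.Nat.Properties as ℕ
open import Data.Nat.Combinatorics using (_C_; nCk+nC[k+1]≡[n+1]C[k+1]; nCk≡nC[n∸k]; nC1≡n; k>n⇒nCk≡0)
import Data.Nat.Tactic.RingSolver as ℕ-Solver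
open import Data.Nat.Coprimality using (1-coprimeTo) renaming (sym to coprime-sym)
import Data.Integer as ℤ
import Data.Integer.Properties as ℤ
open import Data.Rational using (ℚ; mkℚ; 0ℚ; 1ℚ; _+_; _*_; _-_; -_; ↥_; ≢-nonZero)
open import Data.Rational.Properties
  using (_≟_; +-*-commutativeRing; +-identityʳ; normalize-coprime; /-cong; *-inverseʳ;
         +-assoc; +-identityˡ; *-identityˡ; *-identityʳ; *-zeroˡ; *-zeroʳ; *-distribʳ-+; *-distribˡ-+)
open import Data.List using (_∷_; [])
open import Data.Empty using (⊥-elim)
open import Function using (_∘_)
open import Level using (0ℓ)
open import Relation.Nullary using (yes; no)
open import Relation.Nullary.Decidable using (dec⇒maybe)
open import Relation.Binary.PropositionalEquality
open import Tactic.RingSolver using (solve)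
open import Tactic.RingSolver.Core.AlmostCommutativeRing using (AlmostCommutativeRing; fromCommutativeRing)

ℚ-ring : AlmostCommutativeRing 0ℓ 0ℓ
ℚ-ring = fromCommutativeRing +-*-commutativeRing (λ x → dec⇒maybe (0ℚ ≟ x))

ℕ→ℚ-mkℚ : ∀ n → ℕ→ℚ n ≡ mkℚ (ℤ.+ n) 0 (coprime-sym (1-coprimeTo n))
ℕ→ℚ-mkℚ n = normalize-coprime (coprime-sym (1-coprimeTo n))

ℕ→ℚ-suc : ∀ m → ℕ→ℚ (suc m) ≡ 1ℚ + ℕ→ℚ m
ℕ→ℚ-suc m rewrite ℕ→ℚ-mkℚ m = sym (/-cong numerator refl)
  where
  numerator : ℤ.+ 1 ℤ.* ℤ.+ 1 ℤ.+ ℤ.+ m ℤ.* ℤ.+ 1 ≡ ℤ.+ suc m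
  numerator = cong (ℤ._+_ (ℤ.+ 1)) (ℤ.*-identityʳ (ℤ.+ m))

ℕ→ℚ-+ : ∀ a b → ℕ→ℚ (a ℕ.+ b) ≡ ℕ→ℚ a + ℕ→ℚ b
ℕ→ℚ-+ zero    b = sym (+-identityˡ (ℕ→ℚ b))
ℕ→ℚ-+ (suc a) b = begin
  ℕ→ℚ (suc (a ℕ.+ b))         ≡⟨ ℕ→ℚ-suc (a ℕ.+ b) ⟩
  1ℚ + ℕ→ℚ (a ℕ.+ b)          ≡⟨ cong (1ℚ +_) (ℕ→ℚ-+ a b) ⟩
  1ℚ + (ℕ→ℚ a + ℕ→ℚ b)        ≡⟨ sym (+-assoc 1ℚ (ℕ→ℚ a) (ℕ→ℚ b)) ⟩
  (1ℚ + ℕ→ℚ a) + ℕ→ℚ b        ≡⟨ cong (_+ ℕ→ℚ b) (sym (ℕ→ℚ-suc a)) ⟩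
  ℕ→ℚ (suc a) + ℕ→ℚ b         ∎
  where open ≡-Reasoning

ℕ→ℚ-* : ∀ a b → ℕ→ℚ (a ℕ.* b) ≡ ℕ→ℚ a * ℕ→ℚ b
ℕ→ℚ-* zero    b = sym (*-zeroˡ (ℕ→ℚ b))
ℕ→ℚ-* (suc a) b = begin
  ℕ→ℚ (b ℕ.+ a ℕ.* b)         ≡⟨ ℕ→ℚ-+ b (a ℕ.* b) ⟩
  ℕ→ℚ b + ℕ→ℚ (a ℕ.* b)       ≡⟨ cong (ℕ→ℚ b +_) (ℕ→ℚ-* a b) ⟩
  ℕ→ℚ b + ℕ→ℚ a * ℕ→ℚ b       ≡⟨ cong (_+ ℕ→ℚ a * ℕ→ℚ b) (sym (*-identityˡ (ℕ→ℚ b))) ⟩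
  1ℚ * ℕ→ℚ b + ℕ→ℚ a * ℕ→ℚ b  ≡⟨ sym (*-distribʳ-+ (ℕ→ℚ b) 1ℚ (ℕ→ℚ a)) ⟩
  (1ℚ + ℕ→ℚ a) * ℕ→ℚ b        ≡⟨ cong (_* ℕ→ℚ b) (sym (ℕ→ℚ-suc a)) ⟩
  ℕ→ℚ (suc a) * ℕ→ℚ b         ∎
  where open ≡-Reasoning

ℕ→ℚ-cong-* : ∀ a b c d → a ℕ.* b ≡ c ℕ.* d → ℕ→ℚ a * ℕ→ℚ b ≡ ℕ→ℚ c * ℕ→ℚ d
ℕ→ℚ-cong-* a b c d eq = trans (sym (ℕ→ℚ-* a b)) (trans (cong ℕ→ℚ eq) (ℕ→ℚ-* c d))

ℕ→ℚ-odd : ∀ k → ℕ→ℚ (suc (2 ℕ.* k)) ≡ 1ℚ + ℕ→ℚ 2 * ℕ→ℚ k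
ℕ→ℚ-odd k = trans (ℕ→ℚ-suc (2 ℕ.* k)) (cong (1ℚ +_) (ℕ→ℚ-* 2 k))

ℕ→ℚ-injective : ∀ {a b} → ℕ→ℚ a ≡ ℕ→ℚ b → a ≡ b
ℕ→ℚ-injective {a} {b} eq = ℤ.+-injective (cong ↥_ (trans (sym (ℕ→ℚ-mkℚ a)) (trans eq (ℕ→ℚ-mkℚ b))))

ℕ→ℚ-nonzero : ∀ {m} → m ≢ 0 → ℕ→ℚ m ≢ 0ℚ
ℕ→ℚ-nonzero m≢0 = m≢0 ∘ ℕ→ℚ-injective

inv-cancel : ∀ {p} → p ≢ 0ℚ → p * inv p ≡ 1ℚ
inv-cancel {p} p≢0 with p ≟ 0ℚ
... | yes p≡0 = ⊥-elim (p≢0 p≡0)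
... | no  p≢0 = *-inverseʳ p {{≢-nonZero p≢0}}

inv-cancel-left : ∀ {p} → p ≢ 0ℚ → ∀ a → inv p * (p * a) ≡ a
inv-cancel-left {p} p≢0 a = begin
  inv p * (p * a)  ≡⟨ reorder (inv p) p a ⟩
  (p * inv p) * a  ≡⟨ cong (_* a) (inv-cancel p≢0) ⟩
  1ℚ * a           ≡⟨ *-identityˡ a ⟩
  a                ∎
  where
  open ≡-Reasoning
  reorder : ∀ i p a → i * (p * a) ≡ (p * i) * a
  reorder i p a = solve (i ∷ p ∷ a ∷ []) ℚ-ring

*-cancel-nonzero : ∀ {p} a b → p ≢ 0ℚ → p * a ≡ p * b → a ≡ b
*-cancel-nonzero {p} a b p≢0 pa≡pb =
  trans (sym (inv-cancel-left p≢0 a)) (trans (cong (inv p *_) pa≡pb) (inv-cancel-left p≢0 b))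

*-nonzero : ∀ {p q} → p ≢ 0ℚ → q ≢ 0ℚ → p * q ≢ 0ℚ
*-nonzero {p} {q} p≢0 q≢0 pq≡0 =
  q≢0 (trans (sym (inv-cancel-left p≢0 q)) (trans (cong (inv p *_) pq≡0) (*-zeroʳ (inv p))))

inv-unique : ∀ p x → p * x ≡ 1ℚ → x ≡ inv p
inv-unique p x px≡1 = begin
  x                ≡⟨ sym (*-identityʳ x) ⟩
  x * 1ℚ           ≡⟨ cong (x *_) (sym (inv-cancel p≢0)) ⟩
  x * (p * inv p)  ≡⟨ reassociate x p (inv p) ⟩
  (p * x) * inv p  ≡⟨ cong (_* inv p) px≡1 ⟩
  1ℚ * inv p       ≡⟨ *-identityˡ (inv p) ⟩
  inv p            ∎
  where
  open ≡-Reasoning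
  p≢0 : p ≢ 0ℚ
  p≢0 p≡0 with trans (sym px≡1) (trans (cong (_* x) p≡0) (*-zeroˡ x))
  ... | ()
  reassociate : ∀ x p q → x * (p * q) ≡ (p * x) * q
  reassociate x p q = solve (x ∷ p ∷ q ∷ []) ℚ-ring

inv-half : ∀ p → ℕ→ℚ 2 * p ≢ 0ℚ → inv p ≡ ℕ→ℚ 2 * inv (ℕ→ℚ 2 * p)
inv-half p 2p≢0 = sym (inv-unique p (ℕ→ℚ 2 * inv (ℕ→ℚ 2 * p))
                         (trans (reassociate p (inv (ℕ→ℚ 2 * p))) (inv-cancel 2p≢0)))
  where
  reassociate : ∀ p q → p * (ℕ→ℚ 2 * q) ≡ (ℕ→ℚ 2 * p) * q
  reassociate p q = solve (p ∷ q ∷ []) ℚ-ring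

Σ-cong : ∀ m {f g : ℕ → ℚ} → (∀ k → f k ≡ g k) → Σ0to m f ≡ Σ0to m g
Σ-cong zero    f≡g = f≡g 0
Σ-cong (suc m) f≡g = cong₂ _+_ (Σ-cong m f≡g) (f≡g (suc m))

interchange : ∀ a b c d → (a + b) + (c + d) ≡ (a + c) + (b + d)
interchange a b c d = solve (a ∷ b ∷ c ∷ d ∷ []) ℚ-ring

Σ-+ : ∀ m (f g : ℕ → ℚ) → Σ0to m (λ k → f k + g k) ≡ Σ0to m f + Σ0to m g
Σ-+ zero    f g = refl
Σ-+ (suc m) f g = trans (cong (_+ (f (suc m) + g (suc m))) (Σ-+ m f g))
                        (interchange (Σ0to m f) (Σ0to m g) (f (suc m)) (g (suc m)))

Σ-scale : ∀ m c (f : ℕ → ℚ) → Σ0to m (λ k → c * f k) ≡ c * Σ0to m f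
Σ-scale zero    c f = refl
Σ-scale (suc m) c f = trans (cong (_+ c * f (suc m)) (Σ-scale m c f))
                            (sym (*-distribˡ-+ c (Σ0to m f) (f (suc m))))

Σ-peel : ∀ m (f : ℕ → ℚ) → Σ0to (suc m) f ≡ f 0 + Σ0to m (f ∘ suc)
Σ-peel zero    f = refl
Σ-peel (suc m) f = trans (cong (_+ f (suc (suc m))) (Σ-peel m f))
                         (+-assoc (f 0) (Σ0to m (f ∘ suc)) (f (suc (suc m))))

telescope : ∀ m (f G : ℕ → ℚ) → (∀ k → f k ≡ G (suc k) - G k) → Σ0to m f ≡ G (suc m) - G 0
telescope zero    f G f≡ΔG = f≡ΔG 0
telescope (suc m) f G f≡ΔG = begin
  Σ0to m f + f (suc m)                               ≡⟨ cong₂ _+_ (telescope m f G f≡ΔG) (f≡ΔG (suc m)) ⟩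
  (G (suc m) - G 0) + (G (suc (suc m)) - G (suc m))  ≡⟨ collapse (G 0) (G (suc m)) (G (suc (suc m))) ⟩
  G (suc (suc m)) - G 0                              ∎
  where
  open ≡-Reasoning
  collapse : ∀ a b c → (b - a) + (c - b) ≡ c - a
  collapse a b c = solve (a ∷ b ∷ c ∷ []) ℚ-ring

absorption : ∀ n k → suc k ℕ.* (suc n C suc k) ≡ suc n ℕ.* (n C k)
absorption n zero = trans (ℕ.*-identityˡ (suc n C 1)) (trans (nC1≡n (suc n)) (sym (ℕ.*-identityʳ (suc n))))
absorption zero (suc k)
  rewrite k>n⇒nCk≡0 {1} {suc (suc k)} (s≤s (s≤s z≤n)) | k>n⇒nCk≡0 {0} {suc k} (s≤s z≤n) = ℕ.*-zeroʳ (suc (suc k))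
absorption (suc n) (suc k) = begin
  suc (suc k) ℕ.* (suc (suc n) C suc (suc k))      ≡⟨ cong (suc (suc k) ℕ.*_) (sym (nCk+nC[k+1]≡[n+1]C[k+1] (suc n) (suc k))) ⟩
  suc (suc k) ℕ.* (a ℕ.+ b)                         ≡⟨ ℕ.*-distribˡ-+ (suc (suc k)) a b ⟩
  (a ℕ.+ suc k ℕ.* a) ℕ.+ suc (suc k) ℕ.* b         ≡⟨ ℕ.+-assoc a (suc k ℕ.* a) (suc (suc k) ℕ.* b) ⟩
  a ℕ.+ (suc k ℕ.* a ℕ.+ suc (suc k) ℕ.* b)         ≡⟨ cong (a ℕ.+_) (cong₂ ℕ._+_ (absorption n k) (absorption n (suc k))) ⟩
  a ℕ.+ (suc n ℕ.* (n C k) ℕ.+ suc n ℕ.* (n C suc k)) ≡⟨ cong (a ℕ.+_) (sym (ℕ.*-distribˡ-+ (suc n) (n C k) (n C suc k))) ⟩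
  a ℕ.+ suc n ℕ.* (n C k ℕ.+ n C suc k)              ≡⟨ cong (λ z → a ℕ.+ suc n ℕ.* z) (nCk+nC[k+1]≡[n+1]C[k+1] n k) ⟩
  suc (suc n) ℕ.* a                                 ∎
  where
  open ≡-Reasoning
  a = suc n C suc k
  b = suc n C suc (suc k)

central-ratio : ∀ k → suc k ℕ.* ((2 ℕ.* suc k) C suc k) ≡ 2 ℕ.* suc (2 ℕ.* k) ℕ.* ((2 ℕ.* k) C k)
central-ratio k = begin
  suc k ℕ.* ((2 ℕ.* suc k) C suc k)             ≡⟨ cong (λ m → suc k ℕ.* (m C suc k)) (ℕ.*-suc 2 k) ⟩
  suc k ℕ.* (suc (suc m) C suc k)               ≡⟨ absorption (suc m) k ⟩
  suc (suc m) ℕ.* (suc m C k)                   ≡⟨ cong (suc (suc m) ℕ.*_) (nCk≡nC[n∸k] k≤2k+1) ⟩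
  suc (suc m) ℕ.* (suc m C (suc m ℕ.∸ k))       ≡⟨ cong (λ j → suc (suc m) ℕ.* (suc m C j)) 2k+1∸k≡k+1 ⟩
  suc (suc m) ℕ.* (suc m C suc k)               ≡⟨ even-split k (suc m C suc k) ⟩
  2 ℕ.* (suc k ℕ.* (suc m C suc k))             ≡⟨ cong (2 ℕ.*_) (absorption m k) ⟩
  2 ℕ.* (suc m ℕ.* (m C k))                     ≡⟨ sym (ℕ.*-assoc 2 (suc m) (m C k)) ⟩
  2 ℕ.* suc m ℕ.* (m C k)                       ∎
  where
  open ≡-Reasoning
  m = 2 ℕ.* k
  even-split : ∀ k x → suc (suc (2 ℕ.* k)) ℕ.* x ≡ 2 ℕ.* (suc k ℕ.* x)
  even-split = ℕ-Solver.solve-∀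
  2k+1≡k+1+k : suc m ≡ suc k ℕ.+ k
  2k+1≡k+1+k = cong (λ j → suc (k ℕ.+ j)) (ℕ.+-identityʳ k)
  k≤2k+1 : k ℕ.≤ suc m
  k≤2k+1 = subst (k ℕ.≤_) (sym 2k+1≡k+1+k) (ℕ.m≤n+m k (suc k))
  2k+1∸k≡k+1 : suc m ℕ.∸ k ≡ suc k
  2k+1∸k≡k+1 = trans (cong (ℕ._∸ k) 2k+1≡k+1+k) (ℕ.m+n∸n≡m (suc k) k)

binomial-positive : ∀ {n k} → k ℕ.≤ n → 0 ℕ.< n C k
binomial-positive {n}     {zero}  _         = s≤s z≤n
binomial-positive {suc n} {suc k} (s≤s k≤n) =
  subst (0 ℕ.<_) (nCk+nC[k+1]≡[n+1]C[k+1] n k)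
        (ℕ.≤-trans (binomial-positive k≤n) (ℕ.m≤m+n (n C k) (n C suc k)))

pascal : ∀ n k → ℕ→ℚ (suc n C suc k) ≡ ℕ→ℚ (n C k) + ℕ→ℚ (n C suc k)
pascal n k = trans (cong ℕ→ℚ (sym (nCk+nC[k+1]≡[n+1]C[k+1] n k))) (ℕ→ℚ-+ (n C k) (n C suc k))

binomial-step : ∀ n k → (1ℚ + ℕ→ℚ k) * ℕ→ℚ (n C suc k) ≡ (ℕ→ℚ n - ℕ→ℚ k) * ℕ→ℚ (n C k)
binomial-step n k = drop-common-term (ℕ→ℚ n) (ℕ→ℚ k) (ℕ→ℚ (n C k)) (ℕ→ℚ (n C suc k)) absorbed
  where
  open ≡-Reasoning
  drop-common-term : ∀ N K a b → (1ℚ + K) * (a + b) ≡ (1ℚ + N) * a → (1ℚ + K) * b ≡ (N - K) * a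
  drop-common-term N K a b eq = begin
    (1ℚ + K) * b                      ≡⟨ solve (K ∷ a ∷ b ∷ []) ℚ-ring ⟩
    (1ℚ + K) * (a + b) - (1ℚ + K) * a ≡⟨ cong (_- (1ℚ + K) * a) eq ⟩
    (1ℚ + N) * a - (1ℚ + K) * a       ≡⟨ solve (N ∷ K ∷ a ∷ []) ℚ-ring ⟩
    (N - K) * a                       ∎
  absorbed : (1ℚ + ℕ→ℚ k) * (ℕ→ℚ (n C k) + ℕ→ℚ (n C suc k)) ≡ (1ℚ + ℕ→ℚ n) * ℕ→ℚ (n C k)
  absorbed = begin
    (1ℚ + ℕ→ℚ k) * (ℕ→ℚ (n C k) + ℕ→ℚ (n C suc k)) ≡⟨ cong₂ _*_ (sym (ℕ→ℚ-suc k)) (sym (pascal n k)) ⟩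
    ℕ→ℚ (suc k) * ℕ→ℚ (suc n C suc k)                ≡⟨ ℕ→ℚ-cong-* (suc k) (suc n C suc k) (suc n) (n C k) (absorption n k) ⟩
    ℕ→ℚ (suc n) * ℕ→ℚ (n C k)                        ≡⟨ cong (_* ℕ→ℚ (n C k)) (ℕ→ℚ-suc n) ⟩
    (1ℚ + ℕ→ℚ n) * ℕ→ℚ (n C k)                       ∎

odd : ℕ → ℚ
odd k = 1ℚ + ℕ→ℚ 2 * ℕ→ℚ k

odd-nonzero : ∀ k → odd k ≢ 0ℚ
odd-nonzero k = subst (_≢ 0ℚ) (ℕ→ℚ-odd k) (ℕ→ℚ-nonzero {suc (2 ℕ.* k)} (λ ()))

central : ℕ → ℚ
central k = ℕ→ℚ ((2 ℕ.* k) C k)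

central-nonzero : ∀ k → central k ≢ 0ℚ
central-nonzero k = ℕ→ℚ-nonzero (ℕ.m<n⇒n≢0 (binomial-positive (ℕ.m≤n*m k 2)))

coeff : ℕ → ℕ → ℚ
coeff n k = pow (- ℕ→ℚ 4) k * (ℕ→ℚ (n C k) div central k)

ratio : ℕ → ℚ
ratio k = pow (- ℕ→ℚ 4) k * inv (central k)

coeff-ratio : ∀ n k → coeff n k ≡ ℕ→ℚ (n C k) * ratio k
coeff-ratio n k = swap (pow (- ℕ→ℚ 4) k) (ℕ→ℚ (n C k)) (inv (central k))
  where
  swap : ∀ x y z → x * (y * z) ≡ y * (x * z)
  swap x y z = solve (x ∷ y ∷ z ∷ []) ℚ-ring

-- c(n,n+1) = 0, which makes the boundary terms of the telescoping sums vanish.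
coeff-vanishes : ∀ n → coeff n (suc n) ≡ 0ℚ
coeff-vanishes n = begin
  coeff n (suc n)                      ≡⟨ coeff-ratio n (suc n) ⟩
  ℕ→ℚ (n C suc n) * ratio (suc n)      ≡⟨ cong (λ m → ℕ→ℚ m * ratio (suc n)) (k>n⇒nCk≡0 (ℕ.n<1+n n)) ⟩
  0ℚ * ratio (suc n)                   ≡⟨ *-zeroˡ (ratio (suc n)) ⟩
  0ℚ                                   ∎
  where open ≡-Reasoning

ratio-step : ∀ k → odd k * ratio (suc k) ≡ - ℕ→ℚ 2 * (1ℚ + ℕ→ℚ k) * ratio k
ratio-step k =
  quotient-step (pow (- ℕ→ℚ 4) k) (central k) (central (suc k)) (inv (central k)) (inv (central (suc k)))
                (odd k) (1ℚ + ℕ→ℚ k)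
                (inv-cancel (central-nonzero k)) (inv-cancel (central-nonzero (suc k))) central-rational
  where
  open ≡-Reasoning
  quotient-step : ∀ P c c' i i' s e → c * i ≡ 1ℚ → c' * i' ≡ 1ℚ → e * c' ≡ ℕ→ℚ 2 * s * c →
                  s * (- ℕ→ℚ 4 * P * i') ≡ - ℕ→ℚ 2 * e * (P * i)
  quotient-step P c c' i i' s e ci≡1 c'i'≡1 e-c'≡2sc = begin
    s * (- ℕ→ℚ 4 * P * i')                  ≡⟨ solve (s ∷ P ∷ i' ∷ c ∷ i ∷ []) ℚ-ring ⟩
    - ℕ→ℚ 2 * P * i * i' * (ℕ→ℚ 2 * s * c) + s * (- ℕ→ℚ 4 * P * i') * (1ℚ - c * i)
                                             ≡⟨ cong₂ (λ x y → - ℕ→ℚ 2 * P * i * i' * x + s * (- ℕ→ℚ 4 * P * i') * (1ℚ - y))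
                                                      (sym e-c'≡2sc) ci≡1 ⟩
    - ℕ→ℚ 2 * P * i * i' * (e * c') + s * (- ℕ→ℚ 4 * P * i') * (1ℚ - 1ℚ)
                                             ≡⟨ solve (s ∷ P ∷ i' ∷ c' ∷ i ∷ e ∷ []) ℚ-ring ⟩
    - ℕ→ℚ 2 * e * (P * i) * (c' * i')       ≡⟨ cong (- ℕ→ℚ 2 * e * (P * i) *_) c'i'≡1 ⟩
    - ℕ→ℚ 2 * e * (P * i) * 1ℚ              ≡⟨ solve (e ∷ P ∷ i ∷ []) ℚ-ring ⟩
    - ℕ→ℚ 2 * e * (P * i)                   ∎
  central-rational : (1ℚ + ℕ→ℚ k) * central (suc k) ≡ ℕ→ℚ 2 * odd k * central k
  central-rational = begin
    (1ℚ + ℕ→ℚ k) * central (suc k)            ≡⟨ cong (_* central (suc k)) (sym (ℕ→ℚ-suc k)) ⟩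
    ℕ→ℚ (suc k) * central (suc k)             ≡⟨ ℕ→ℚ-cong-* (suc k) ((2 ℕ.* suc k) C suc k) (2 ℕ.* suc (2 ℕ.* k)) ((2 ℕ.* k) C k) (central-ratio k) ⟩
    ℕ→ℚ (2 ℕ.* suc (2 ℕ.* k)) * central k     ≡⟨ cong (_* central k) (trans (ℕ→ℚ-* 2 (suc (2 ℕ.* k))) (cong (ℕ→ℚ 2 *_) (ℕ→ℚ-odd k))) ⟩
    ℕ→ℚ 2 * odd k * central k                 ∎

coeff-step : ∀ n k → odd k * coeff n (suc k) ≡ - ℕ→ℚ 2 * (ℕ→ℚ n - ℕ→ℚ k) * coeff n k
coeff-step n k = begin
  odd k * coeff n (suc k)                          ≡⟨ cong (odd k *_) (coeff-ratio n (suc k)) ⟩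
  odd k * (ℕ→ℚ (n C suc k) * ratio (suc k))        ≡⟨ combine (odd k) (1ℚ + ℕ→ℚ k) (ℕ→ℚ n - ℕ→ℚ k)
                                                              (ratio k) (ratio (suc k)) (ℕ→ℚ (n C k)) (ℕ→ℚ (n C suc k))
                                                              (ratio-step k) (binomial-step n k) ⟩
  - ℕ→ℚ 2 * (ℕ→ℚ n - ℕ→ℚ k) * (ℕ→ℚ (n C k) * ratio k) ≡⟨ cong (- ℕ→ℚ 2 * (ℕ→ℚ n - ℕ→ℚ k) *_) (sym (coeff-ratio n k)) ⟩
  - ℕ→ℚ 2 * (ℕ→ℚ n - ℕ→ℚ k) * coeff n k            ∎
  where
  open ≡-Reasoning
  combine : ∀ s e d r r' b b' → s * r' ≡ - ℕ→ℚ 2 * e * r → e * b' ≡ d * b →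
            s * (b' * r') ≡ - ℕ→ℚ 2 * d * (b * r)
  combine s e d r r' b b' sr'≡ eb'≡ = begin
    s * (b' * r')             ≡⟨ solve (s ∷ b' ∷ r' ∷ []) ℚ-ring ⟩
    b' * (s * r')             ≡⟨ cong (b' *_) sr'≡ ⟩
    b' * (- ℕ→ℚ 2 * e * r)    ≡⟨ solve (b' ∷ e ∷ r ∷ []) ℚ-ring ⟩
    - ℕ→ℚ 2 * r * (e * b')    ≡⟨ cong (- ℕ→ℚ 2 * r *_) eb'≡ ⟩
    - ℕ→ℚ 2 * r * (d * b)     ≡⟨ solve (r ∷ d ∷ b ∷ []) ℚ-ring ⟩
    - ℕ→ℚ 2 * d * (b * r)     ∎

coeff-pascal : ∀ n k → odd k * coeff (suc n) (suc k)
                     ≡ odd k * coeff n (suc k) - ℕ→ℚ 2 * (1ℚ + ℕ→ℚ k) * coeff n k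
coeff-pascal n k = begin
  odd k * coeff (suc n) (suc k)                              ≡⟨ cong (odd k *_) (coeff-ratio (suc n) (suc k)) ⟩
  odd k * (ℕ→ℚ (suc n C suc k) * ratio (suc k))              ≡⟨ cong (λ x → odd k * (x * ratio (suc k))) (pascal n k) ⟩
  odd k * ((b + b') * ratio (suc k))                         ≡⟨ split (odd k) (1ℚ + ℕ→ℚ k) (ratio k) (ratio (suc k)) b b' (ratio-step k) ⟩
  odd k * (b' * ratio (suc k)) - ℕ→ℚ 2 * (1ℚ + ℕ→ℚ k) * (b * ratio k)
                                                             ≡⟨ sym (cong₂ (λ x y → odd k * x - ℕ→ℚ 2 * (1ℚ + ℕ→ℚ k) * y)
                                                                           (coeff-ratio n (suc k)) (coeff-ratio n k)) ⟩
  odd k * coeff n (suc k) - ℕ→ℚ 2 * (1ℚ + ℕ→ℚ k) * coeff n k ∎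
  where
  open ≡-Reasoning
  b  = ℕ→ℚ (n C k)
  b' = ℕ→ℚ (n C suc k)
  split : ∀ s e r r' b b' → s * r' ≡ - ℕ→ℚ 2 * e * r →
          s * ((b + b') * r') ≡ s * (b' * r') - ℕ→ℚ 2 * e * (b * r)
  split s e r r' b b' sr'≡ = begin
    s * ((b + b') * r')                      ≡⟨ solve (s ∷ b ∷ b' ∷ r' ∷ []) ℚ-ring ⟩
    s * (b' * r') + b * (s * r')             ≡⟨ cong (λ x → s * (b' * r') + b * x) sr'≡ ⟩
    s * (b' * r') + b * (- ℕ→ℚ 2 * e * r)    ≡⟨ solve (s ∷ b' ∷ r' ∷ b ∷ e ∷ r ∷ []) ℚ-ring ⟩
    s * (b' * r') - ℕ→ℚ 2 * e * (b * r)      ∎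

sum-coeff : ∀ n → (ℕ→ℚ 2 * ℕ→ℚ n - 1ℚ) * Σ0to n (coeff n) ≡ - 1ℚ
sum-coeff n = begin
  D * Σ0to n (coeff n)                         ≡⟨ sym (Σ-scale n D (coeff n)) ⟩
  Σ0to n (λ k → D * coeff n k)                 ≡⟨ telescope n (λ k → D * coeff n k) A difference ⟩
  A (suc n) - A 0                              ≡⟨ cong (λ x → (1ℚ - ℕ→ℚ 2 * ℕ→ℚ (suc n)) * x - A 0) (coeff-vanishes n) ⟩
  (1ℚ - ℕ→ℚ 2 * ℕ→ℚ (suc n)) * 0ℚ - 1ℚ         ≡⟨ cong (_- 1ℚ) (*-zeroʳ (1ℚ - ℕ→ℚ 2 * ℕ→ℚ (suc n))) ⟩
  - 1ℚ                                         ∎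
  where
  open ≡-Reasoning
  D = ℕ→ℚ 2 * ℕ→ℚ n - 1ℚ
  A : ℕ → ℚ
  A k = (1ℚ - ℕ→ℚ 2 * ℕ→ℚ k) * coeff n k
  antidifference-step : ∀ N K a a' → (1ℚ + ℕ→ℚ 2 * K) * a' ≡ - ℕ→ℚ 2 * (N - K) * a →
        (ℕ→ℚ 2 * N - 1ℚ) * a ≡ (1ℚ - ℕ→ℚ 2 * (1ℚ + K)) * a' - (1ℚ - ℕ→ℚ 2 * K) * a
  antidifference-step N K a a' step = begin
    (ℕ→ℚ 2 * N - 1ℚ) * a                             ≡⟨ solve (N ∷ K ∷ a ∷ []) ℚ-ring ⟩
    - (- ℕ→ℚ 2 * (N - K) * a) - (1ℚ - ℕ→ℚ 2 * K) * a  ≡⟨ cong (λ x → - x - (1ℚ - ℕ→ℚ 2 * K) * a) (sym step) ⟩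
    - ((1ℚ + ℕ→ℚ 2 * K) * a') - (1ℚ - ℕ→ℚ 2 * K) * a ≡⟨ solve (K ∷ a ∷ a' ∷ []) ℚ-ring ⟩
    (1ℚ - ℕ→ℚ 2 * (1ℚ + K)) * a' - (1ℚ - ℕ→ℚ 2 * K) * a ∎
  difference : ∀ k → D * coeff n k ≡ A (suc k) - A k
  difference k = trans (antidifference-step (ℕ→ℚ n) (ℕ→ℚ k) (coeff n k) (coeff n (suc k)) (coeff-step n k))
                       (cong (λ x → (1ℚ - ℕ→ℚ 2 * x) * coeff n (suc k) - A k) (sym (ℕ→ℚ-suc k)))

sum-coeff-odd : ∀ n → Σ0to n (λ k → coeff n k * inv (odd k)) ≡ inv (odd n)
sum-coeff-odd n = inv-unique (odd n) (Σ0to n f) (begin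
  odd n * Σ0to n f                 ≡⟨ sym (Σ-scale n (odd n) f) ⟩
  Σ0to n (λ k → odd n * f k)       ≡⟨ telescope n (λ k → odd n * f k) B difference ⟩
  B (suc n) - B 0                  ≡⟨ cong (λ x → - x - B 0) (coeff-vanishes n) ⟩
  1ℚ                               ∎)
  where
  open ≡-Reasoning
  f : ℕ → ℚ
  f k = coeff n k * inv (odd k)
  B : ℕ → ℚ
  B k = - coeff n k
  antidifference-step : ∀ N K a a' i → (1ℚ + ℕ→ℚ 2 * K) * i ≡ 1ℚ → (1ℚ + ℕ→ℚ 2 * K) * a' ≡ - ℕ→ℚ 2 * (N - K) * a →
        (1ℚ + ℕ→ℚ 2 * N) * (a * i) ≡ - a' - - a
  antidifference-step N K a a' i si≡1 step = begin
    (1ℚ + ℕ→ℚ 2 * N) * (a * i)                                    ≡⟨ solve (N ∷ K ∷ a ∷ i ∷ []) ℚ-ring ⟩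
    ((1ℚ + ℕ→ℚ 2 * K) * a - - ℕ→ℚ 2 * (N - K) * a) * i           ≡⟨ cong (λ x → ((1ℚ + ℕ→ℚ 2 * K) * a - x) * i) (sym step) ⟩
    ((1ℚ + ℕ→ℚ 2 * K) * a - (1ℚ + ℕ→ℚ 2 * K) * a') * i            ≡⟨ solve (K ∷ a ∷ a' ∷ i ∷ []) ℚ-ring ⟩
    (a - a') * ((1ℚ + ℕ→ℚ 2 * K) * i)                            ≡⟨ cong ((a - a') *_) si≡1 ⟩
    (a - a') * 1ℚ                                                 ≡⟨ solve (a ∷ a' ∷ []) ℚ-ring ⟩
    - a' - - a                                                    ∎
  difference : ∀ k → odd n * f k ≡ B (suc k) - B k
  difference k = antidifference-step (ℕ→ℚ n) (ℕ→ℚ k) (coeff n k) (coeff n (suc k)) (inv (odd k))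
                     (inv-cancel (odd-nonzero k)) (coeff-step n k)

-- The reciprocal sum R(n) = Σ_{k=1}^n c(n,k)/k; the k = 0 term is 0 because inv 0 = 0.
recip-sum : ℕ → ℚ
recip-sum n = Σ0to n (λ k → coeff n k * inv (ℕ→ℚ k))

coeff-pascal-divided : ∀ n k → coeff (suc n) (suc k) * inv (ℕ→ℚ (suc k))
                             ≡ coeff n (suc k) * inv (ℕ→ℚ (suc k)) + - ℕ→ℚ 2 * (coeff n k * inv (odd k))
coeff-pascal-divided n k =
  divide-by-denominators (ℕ→ℚ k) (ℕ→ℚ (suc k)) (coeff (suc n) (suc k)) (coeff n (suc k)) (coeff n k)
      (inv (odd k)) (inv (ℕ→ℚ (suc k)))
      (ℕ→ℚ-suc k) (coeff-pascal n k) (inv-cancel (odd-nonzero k)) (inv-cancel (ℕ→ℚ-nonzero {suc k} (λ ())))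
  where
  open ≡-Reasoning
  divide-by-denominators : ∀ K e x y z i j → e ≡ 1ℚ + K →
        (1ℚ + ℕ→ℚ 2 * K) * x ≡ (1ℚ + ℕ→ℚ 2 * K) * y - ℕ→ℚ 2 * (1ℚ + K) * z →
        (1ℚ + ℕ→ℚ 2 * K) * i ≡ 1ℚ → e * j ≡ 1ℚ → x * j ≡ y * j + - ℕ→ℚ 2 * (z * i)
  divide-by-denominators K _ x y z i j refl pascal-step si≡1 ej≡1 = begin
    x * j                                                      ≡⟨ solve (x ∷ j ∷ []) ℚ-ring ⟩
    x * j * 1ℚ                                                 ≡⟨ cong (x * j *_) (sym si≡1) ⟩
    x * j * ((1ℚ + ℕ→ℚ 2 * K) * i)                             ≡⟨ solve (x ∷ j ∷ K ∷ i ∷ []) ℚ-ring ⟩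
    (1ℚ + ℕ→ℚ 2 * K) * x * (j * i)                             ≡⟨ cong (_* (j * i)) pascal-step ⟩
    ((1ℚ + ℕ→ℚ 2 * K) * y - ℕ→ℚ 2 * (1ℚ + K) * z) * (j * i)   ≡⟨ solve (K ∷ y ∷ z ∷ j ∷ i ∷ []) ℚ-ring ⟩
    y * j * ((1ℚ + ℕ→ℚ 2 * K) * i) - ℕ→ℚ 2 * (z * i) * ((1ℚ + K) * j)
                                                               ≡⟨ cong₂ (λ p q → y * j * p - ℕ→ℚ 2 * (z * i) * q) si≡1 ej≡1 ⟩
    y * j * 1ℚ - ℕ→ℚ 2 * (z * i) * 1ℚ                          ≡⟨ solve (y ∷ j ∷ z ∷ i ∷ []) ℚ-ring ⟩
    y * j + - ℕ→ℚ 2 * (z * i)                                  ∎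

recip-sum-step : ∀ n → recip-sum (suc n) ≡ recip-sum n + - ℕ→ℚ 2 * Σ0to n (λ k → coeff n k * inv (odd k))
recip-sum-step n = begin
  recip-sum (suc n)                                   ≡⟨ Σ-peel n (λ k → coeff (suc n) k * inv (ℕ→ℚ k)) ⟩
  0ℚ + Σ0to n (λ k → coeff (suc n) (suc k) * inv (ℕ→ℚ (suc k)))
                                                      ≡⟨ +-identityˡ _ ⟩
  Σ0to n (λ k → coeff (suc n) (suc k) * inv (ℕ→ℚ (suc k)))
                                                      ≡⟨ Σ-cong n (coeff-pascal-divided n) ⟩
  Σ0to n (λ k → g k + - ℕ→ℚ 2 * h k)                  ≡⟨ Σ-+ n g (λ k → - ℕ→ℚ 2 * h k) ⟩
  Σ0to n g + Σ0to n (λ k → - ℕ→ℚ 2 * h k)             ≡⟨ cong₂ _+_ shifted (Σ-scale n (- ℕ→ℚ 2) h) ⟩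
  recip-sum n + - ℕ→ℚ 2 * Σ0to n h                    ∎
  where
  open ≡-Reasoning
  g h : ℕ → ℚ
  g k = coeff n (suc k) * inv (ℕ→ℚ (suc k))
  h k = coeff n k * inv (odd k)
  -- the terms k = 1, …, n+1 of R(n), the last of which is zero
  shifted : Σ0to n g ≡ recip-sum n
  shifted = begin
    Σ0to n g                                          ≡⟨ sym (+-identityˡ (Σ0to n g)) ⟩
    0ℚ + Σ0to n g                                     ≡⟨ sym (Σ-peel n (λ k → coeff n k * inv (ℕ→ℚ k))) ⟩
    recip-sum n + coeff n (suc n) * inv (ℕ→ℚ (suc n)) ≡⟨ cong (λ x → recip-sum n + x * inv (ℕ→ℚ (suc n))) (coeff-vanishes n) ⟩
    recip-sum n + 0ℚ * inv (ℕ→ℚ (suc n))              ≡⟨ cong (recip-sum n +_) (*-zeroˡ (inv (ℕ→ℚ (suc n)))) ⟩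
    recip-sum n + 0ℚ                                  ≡⟨ +-identityʳ (recip-sum n) ⟩
    recip-sum n                                       ∎

H-double : ∀ k → H (2 ℕ.* suc k) ≡ H (2 ℕ.* k) + inv (odd k) + inv (ℕ→ℚ 2 * (1ℚ + ℕ→ℚ k))
H-double k = trans (cong H (ℕ.*-suc 2 k))
                   (cong₂ (λ x y → H (2 ℕ.* k) + inv x + inv y) (ℕ→ℚ-odd k) even)
  where
  even : ℕ→ℚ (suc (suc (2 ℕ.* k))) ≡ ℕ→ℚ 2 * (1ℚ + ℕ→ℚ k)
  even = trans (cong ℕ→ℚ (sym (ℕ.*-suc 2 k))) (trans (ℕ→ℚ-* 2 (suc k)) (cong (ℕ→ℚ 2 *_) (ℕ→ℚ-suc k)))

even-nonzero : ∀ k → ℕ→ℚ 2 * (1ℚ + ℕ→ℚ k) ≢ 0ℚ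
even-nonzero k = subst (_≢ 0ℚ) (trans (ℕ→ℚ-* 2 (suc k)) (cong (ℕ→ℚ 2 *_) (ℕ→ℚ-suc k)))
                       (ℕ→ℚ-nonzero {2 ℕ.* suc k} (λ ()))

inv-suc-half : ∀ k → inv (ℕ→ℚ (suc k)) ≡ ℕ→ℚ 2 * inv (ℕ→ℚ 2 * (1ℚ + ℕ→ℚ k))
inv-suc-half k = trans (cong inv (ℕ→ℚ-suc k)) (inv-half (1ℚ + ℕ→ℚ k) (even-nonzero k))

-- H_{n+1} - 2H_{2n+2} = H_n - 2H_{2n} - 2/(2n+1), since 1/(n+1) = 2/(2n+2).
harmonic-step : ∀ n → H n - ℕ→ℚ 2 * H (2 ℕ.* n) + - ℕ→ℚ 2 * inv (odd n) ≡ H (suc n) - ℕ→ℚ 2 * H (2 ℕ.* suc n)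
harmonic-step n = begin
  H n - ℕ→ℚ 2 * H (2 ℕ.* n) + - ℕ→ℚ 2 * inv (odd n)
    ≡⟨ substitute-half (H n) (H (2 ℕ.* n)) (inv (odd n)) v (inv (ℕ→ℚ (suc n))) (inv-suc-half n) ⟩
  (H n + inv (ℕ→ℚ (suc n))) - ℕ→ℚ 2 * (H (2 ℕ.* n) + inv (odd n) + v)
    ≡⟨ cong (λ x → H (suc n) - ℕ→ℚ 2 * x) (sym (H-double n)) ⟩
  H (suc n) - ℕ→ℚ 2 * H (2 ℕ.* suc n) ∎
  where
  open ≡-Reasoning
  v = inv (ℕ→ℚ 2 * (1ℚ + ℕ→ℚ n))
  substitute-half : ∀ h h₂ u v w → w ≡ ℕ→ℚ 2 * v → h - ℕ→ℚ 2 * h₂ + - ℕ→ℚ 2 * u ≡ (h + w) - ℕ→ℚ 2 * (h₂ + u + v)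
  substitute-half h h₂ u v _ refl = solve (h ∷ h₂ ∷ u ∷ v ∷ []) ℚ-ring

sum-coeff-recip : ∀ n → recip-sum n ≡ H n - ℕ→ℚ 2 * H (2 ℕ.* n)
sum-coeff-recip zero    = refl
sum-coeff-recip (suc n) = begin
  recip-sum (suc n)                                            ≡⟨ recip-sum-step n ⟩
  recip-sum n + - ℕ→ℚ 2 * Σ0to n (λ k → coeff n k * inv (odd k))
                                                               ≡⟨ cong₂ (λ x y → x + - ℕ→ℚ 2 * y) (sum-coeff-recip n) (sum-coeff-odd n) ⟩
  H n - ℕ→ℚ 2 * H (2 ℕ.* n) + - ℕ→ℚ 2 * inv (odd n)           ≡⟨ harmonic-step n ⟩
  H (suc n) - ℕ→ℚ 2 * H (2 ℕ.* suc n)                          ∎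
  where open ≡-Reasoning

-- 2(2k+1) (1/(2k+1) + 1/(2k+2)) = 4 - 1/(k+1): the increment of H_{2k} weighted as in the main sum.
harmonic-increment : ∀ k → ℕ→ℚ 2 * odd k * (inv (odd k) + inv (ℕ→ℚ 2 * (1ℚ + ℕ→ℚ k))) ≡ ℕ→ℚ 4 - inv (ℕ→ℚ (suc k))
harmonic-increment k =
  cancel-denominators (ℕ→ℚ k) (inv (odd k)) (inv (ℕ→ℚ 2 * (1ℚ + ℕ→ℚ k))) (inv (ℕ→ℚ (suc k)))
      (inv-cancel (odd-nonzero k)) (inv-cancel (even-nonzero k)) (inv-suc-half k)
  where
  open ≡-Reasoning
  cancel-denominators : ∀ K u v w → (1ℚ + ℕ→ℚ 2 * K) * u ≡ 1ℚ → ℕ→ℚ 2 * (1ℚ + K) * v ≡ 1ℚ → w ≡ ℕ→ℚ 2 * v →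
        ℕ→ℚ 2 * (1ℚ + ℕ→ℚ 2 * K) * (u + v) ≡ ℕ→ℚ 4 - w
  cancel-denominators K u v _ su≡1 ev≡1 refl = begin
    ℕ→ℚ 2 * (1ℚ + ℕ→ℚ 2 * K) * (u + v)                              ≡⟨ solve (K ∷ u ∷ v ∷ []) ℚ-ring ⟩
    ℕ→ℚ 2 * ((1ℚ + ℕ→ℚ 2 * K) * u) + ℕ→ℚ 2 * (ℕ→ℚ 2 * (1ℚ + K) * v) - ℕ→ℚ 2 * v
                                                                    ≡⟨ cong₂ (λ p q → ℕ→ℚ 2 * p + ℕ→ℚ 2 * q - ℕ→ℚ 2 * v) su≡1 ev≡1 ⟩
    ℕ→ℚ 2 * 1ℚ + ℕ→ℚ 2 * 1ℚ - ℕ→ℚ 2 * v                             ≡⟨ solve (v ∷ []) ℚ-ring ⟩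
    ℕ→ℚ 4 - ℕ→ℚ 2 * v                                               ∎

-- The main telescoping identity
--   2(2n-1) Σ_k c(n,k) H_{2k} - 4 Σ_k c(n,k) + R(n) = -4
-- sums the terms  c(n,k) (2(2n-1) H_{2k} - 4 + 1/k)  against the antidifference
-- G(0) = 4, G(k+1) = -2(2k+1) H_{2k} c(n,k+1).
harmonic-term : ℕ → ℕ → ℚ
harmonic-term n k = coeff n k * (ℕ→ℚ 2 * (ℕ→ℚ 2 * ℕ→ℚ n - 1ℚ) * H (2 ℕ.* k) - ℕ→ℚ 4 + inv (ℕ→ℚ k))

harmonic-antidifference : ℕ → ℕ → ℚ
harmonic-antidifference n zero    = ℕ→ℚ 4
harmonic-antidifference n (suc k) = - ℕ→ℚ 2 * odd k * H (2 ℕ.* k) * coeff n (suc k)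

harmonic-difference : ∀ n k → harmonic-term n k ≡ harmonic-antidifference n (suc k) - harmonic-antidifference n k
harmonic-difference n zero    = first-term (ℕ→ℚ n) (coeff n 1)
  where
  first-term : ∀ N c → 1ℚ * (ℕ→ℚ 2 * (ℕ→ℚ 2 * N - 1ℚ) * 0ℚ - ℕ→ℚ 4 + 0ℚ) ≡ - ℕ→ℚ 2 * 1ℚ * 0ℚ * c - ℕ→ℚ 4
  first-term N c = solve (N ∷ c ∷ []) ℚ-ring
harmonic-difference n (suc k) =
  later-term (ℕ→ℚ n) (ℕ→ℚ k) (ℕ→ℚ (suc k)) (coeff n (suc k)) (coeff n (suc (suc k)))
             (H (2 ℕ.* k)) (inv (odd k)) (inv (ℕ→ℚ 2 * (1ℚ + ℕ→ℚ k))) (inv (ℕ→ℚ (suc k))) (H (2 ℕ.* suc k))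
             (ℕ→ℚ-suc k) (H-double k) (coeff-step n (suc k)) (harmonic-increment k)
  where
  open ≡-Reasoning
  later-term : ∀ N K J a a' h u v w H' → J ≡ 1ℚ + K → H' ≡ h + u + v →
               (1ℚ + ℕ→ℚ 2 * J) * a' ≡ - ℕ→ℚ 2 * (N - J) * a →
               ℕ→ℚ 2 * (1ℚ + ℕ→ℚ 2 * K) * (u + v) ≡ ℕ→ℚ 4 - w →
               a * (ℕ→ℚ 2 * (ℕ→ℚ 2 * N - 1ℚ) * H' - ℕ→ℚ 4 + w)
                 ≡ - ℕ→ℚ 2 * (1ℚ + ℕ→ℚ 2 * J) * H' * a' - - ℕ→ℚ 2 * (1ℚ + ℕ→ℚ 2 * K) * h * a
  later-term N K _ a a' h u v w _ refl refl step increment = begin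
    a * (ℕ→ℚ 2 * (ℕ→ℚ 2 * N - 1ℚ) * (h + u + v) - ℕ→ℚ 4 + w)
      ≡⟨ solve (a ∷ N ∷ h ∷ u ∷ v ∷ w ∷ []) ℚ-ring ⟩
    ℕ→ℚ 2 * (ℕ→ℚ 2 * N - 1ℚ) * (h + u + v) * a - (ℕ→ℚ 4 - w) * a
      ≡⟨ cong (λ x → ℕ→ℚ 2 * (ℕ→ℚ 2 * N - 1ℚ) * (h + u + v) * a - x * a) (sym increment) ⟩
    ℕ→ℚ 2 * (ℕ→ℚ 2 * N - 1ℚ) * (h + u + v) * a - ℕ→ℚ 2 * (1ℚ + ℕ→ℚ 2 * K) * (u + v) * a
      ≡⟨ solve (N ∷ K ∷ a ∷ h ∷ u ∷ v ∷ []) ℚ-ring ⟩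
    - ℕ→ℚ 2 * (h + u + v) * (- ℕ→ℚ 2 * (N - (1ℚ + K)) * a) + ℕ→ℚ 2 * (1ℚ + ℕ→ℚ 2 * K) * h * a
      ≡⟨ cong (λ x → - ℕ→ℚ 2 * (h + u + v) * x + ℕ→ℚ 2 * (1ℚ + ℕ→ℚ 2 * K) * h * a) (sym step) ⟩
    - ℕ→ℚ 2 * (h + u + v) * ((1ℚ + ℕ→ℚ 2 * (1ℚ + K)) * a') + ℕ→ℚ 2 * (1ℚ + ℕ→ℚ 2 * K) * h * a
      ≡⟨ solve (K ∷ a ∷ a' ∷ h ∷ u ∷ v ∷ []) ℚ-ring ⟩
    - ℕ→ℚ 2 * (1ℚ + ℕ→ℚ 2 * (1ℚ + K)) * (h + u + v) * a' - - ℕ→ℚ 2 * (1ℚ + ℕ→ℚ 2 * K) * h * a ∎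

harmonic-sum : ∀ n → ℕ→ℚ 2 * (ℕ→ℚ 2 * ℕ→ℚ n - 1ℚ) * LHS n + - ℕ→ℚ 4 * Σ0to n (coeff n) + recip-sum n ≡ - ℕ→ℚ 4
harmonic-sum n = begin
  α * LHS n + - ℕ→ℚ 4 * Σ0to n (coeff n) + recip-sum n  ≡⟨ sym split ⟩
  Σ0to n (harmonic-term n)                               ≡⟨ telescope n (harmonic-term n) G (harmonic-difference n) ⟩
  G (suc n) - G 0                                        ≡⟨ cong (λ x → - ℕ→ℚ 2 * odd n * H (2 ℕ.* n) * x - ℕ→ℚ 4) (coeff-vanishes n) ⟩
  - ℕ→ℚ 2 * odd n * H (2 ℕ.* n) * 0ℚ - ℕ→ℚ 4            ≡⟨ cong (_- ℕ→ℚ 4) (*-zeroʳ (- ℕ→ℚ 2 * odd n * H (2 ℕ.* n))) ⟩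
  - ℕ→ℚ 4                                                ∎
  where
  open ≡-Reasoning
  α = ℕ→ℚ 2 * (ℕ→ℚ 2 * ℕ→ℚ n - 1ℚ)
  G = harmonic-antidifference n
  expand : ∀ c a h w → c * (a * h - ℕ→ℚ 4 + w) ≡ (a * (c * h) + - ℕ→ℚ 4 * c) + c * w
  expand c a h w = solve (c ∷ a ∷ h ∷ w ∷ []) ℚ-ring
  split : Σ0to n (harmonic-term n) ≡ α * LHS n + - ℕ→ℚ 4 * Σ0to n (coeff n) + recip-sum n
  split = begin
    Σ0to n (harmonic-term n)
      ≡⟨ Σ-cong n (λ k → expand (coeff n k) α (H (2 ℕ.* k)) (inv (ℕ→ℚ k))) ⟩
    Σ0to n (λ k → (α * (coeff n k * H (2 ℕ.* k)) + - ℕ→ℚ 4 * coeff n k) + coeff n k * inv (ℕ→ℚ k))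
      ≡⟨ Σ-+ n _ _ ⟩
    Σ0to n (λ k → α * (coeff n k * H (2 ℕ.* k)) + - ℕ→ℚ 4 * coeff n k) + recip-sum n
      ≡⟨ cong (_+ recip-sum n) (Σ-+ n _ _) ⟩
    Σ0to n (λ k → α * (coeff n k * H (2 ℕ.* k))) + Σ0to n (λ k → - ℕ→ℚ 4 * coeff n k) + recip-sum n
      ≡⟨ cong₂ (λ x y → x + y + recip-sum n) (Σ-scale n α (λ k → coeff n k * H (2 ℕ.* k))) (Σ-scale n (- ℕ→ℚ 4) (coeff n)) ⟩
    α * LHS n + - ℕ→ℚ 4 * Σ0to n (coeff n) + recip-sum n ∎

solve-for-sum : ∀ N T M F S R A B → T ≡ ℕ→ℚ 2 * N - 1ℚ → M ≡ ℕ→ℚ 4 * N →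
                (ℕ→ℚ 2 * N - 1ℚ) * S ≡ - 1ℚ →
                ℕ→ℚ 2 * (ℕ→ℚ 2 * N - 1ℚ) * F + - ℕ→ℚ 4 * S + R ≡ - ℕ→ℚ 4 →
                R ≡ A - ℕ→ℚ 2 * B →
                F ≡ (ℕ→ℚ 2 * B - A) * inv (ℕ→ℚ 2 * T) - M * inv (T * T)
solve-for-sum N _ _ F S R A B refl refl DS≡-1 main R≡ =
  cleared (ℕ→ℚ 2 * N - 1ℚ) (ℕ→ℚ 4 * N) F S R A B (inv (ℕ→ℚ 2 * D)) (inv (D * D))
          (four-n N) DS≡-1 main R≡ (inv-cancel 2D≢0) (inv-cancel DD≢0) (*-nonzero 2D≢0 DD≢0)
  where
  open ≡-Reasoning
  D = ℕ→ℚ 2 * N - 1ℚ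
  D≢0 : D ≢ 0ℚ
  D≢0 D≡0 with trans (sym DS≡-1) (trans (cong (_* S) D≡0) (*-zeroˡ S))
  ... | ()
  2D≢0 : ℕ→ℚ 2 * D ≢ 0ℚ
  2D≢0 = *-nonzero (ℕ→ℚ-nonzero {2} (λ ())) D≢0
  DD≢0 : D * D ≢ 0ℚ
  DD≢0 = *-nonzero D≢0 D≢0
  four-n : ∀ N → ℕ→ℚ 4 * N ≡ ℕ→ℚ 2 * (1ℚ + (ℕ→ℚ 2 * N - 1ℚ))
  four-n N = solve (N ∷ []) ℚ-ring
  -- both sides multiplied by 2D·D² agree, with x = 1/(2D), y = 1/D²
  cleared : ∀ D M F S R A B x y → M ≡ ℕ→ℚ 2 * (1ℚ + D) →
            D * S ≡ - 1ℚ → ℕ→ℚ 2 * D * F + - ℕ→ℚ 4 * S + R ≡ - ℕ→ℚ 4 → R ≡ A - ℕ→ℚ 2 * B →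
            ℕ→ℚ 2 * D * x ≡ 1ℚ → D * D * y ≡ 1ℚ → ℕ→ℚ 2 * D * (D * D) ≢ 0ℚ →
            F ≡ (ℕ→ℚ 2 * B - A) * x - M * y
  cleared D _ F S R A B x y refl DS≡-1 main R≡ 2Dx≡1 DDy≡1 P≢0 =
    *-cancel-nonzero F ((ℕ→ℚ 2 * B - A) * x - ℕ→ℚ 2 * (1ℚ + D) * y) P≢0 (trans left (sym right))
    where
    left : ℕ→ℚ 2 * D * (D * D) * F ≡ D * D * (- ℕ→ℚ 4) + ℕ→ℚ 4 * D * (- 1ℚ) - D * D * (A - ℕ→ℚ 2 * B)
    left = begin
      ℕ→ℚ 2 * D * (D * D) * F
        ≡⟨ solve (D ∷ F ∷ S ∷ R ∷ []) ℚ-ring ⟩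
      D * D * (ℕ→ℚ 2 * D * F + - ℕ→ℚ 4 * S + R) + ℕ→ℚ 4 * D * (D * S) - D * D * R
        ≡⟨ cong₂ (λ p q → D * D * p + ℕ→ℚ 4 * D * q - D * D * R) main DS≡-1 ⟩
      D * D * (- ℕ→ℚ 4) + ℕ→ℚ 4 * D * (- 1ℚ) - D * D * R
        ≡⟨ cong (λ r → D * D * (- ℕ→ℚ 4) + ℕ→ℚ 4 * D * (- 1ℚ) - D * D * r) R≡ ⟩
      D * D * (- ℕ→ℚ 4) + ℕ→ℚ 4 * D * (- 1ℚ) - D * D * (A - ℕ→ℚ 2 * B) ∎
    right : ℕ→ℚ 2 * D * (D * D) * ((ℕ→ℚ 2 * B - A) * x - ℕ→ℚ 2 * (1ℚ + D) * y)
            ≡ D * D * (- ℕ→ℚ 4) + ℕ→ℚ 4 * D * (- 1ℚ) - D * D * (A - ℕ→ℚ 2 * B)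
    right = begin
      ℕ→ℚ 2 * D * (D * D) * ((ℕ→ℚ 2 * B - A) * x - ℕ→ℚ 2 * (1ℚ + D) * y)
        ≡⟨ solve (D ∷ A ∷ B ∷ x ∷ y ∷ []) ℚ-ring ⟩
      D * D * (ℕ→ℚ 2 * B - A) * (ℕ→ℚ 2 * D * x) - ℕ→ℚ 2 * D * (ℕ→ℚ 2 * (1ℚ + D)) * (D * D * y)
        ≡⟨ cong₂ (λ p q → D * D * (ℕ→ℚ 2 * B - A) * p - ℕ→ℚ 2 * D * (ℕ→ℚ 2 * (1ℚ + D)) * q) 2Dx≡1 DDy≡1 ⟩
      D * D * (ℕ→ℚ 2 * B - A) * 1ℚ - ℕ→ℚ 2 * D * (ℕ→ℚ 2 * (1ℚ + D)) * 1ℚ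
        ≡⟨ solve (D ∷ A ∷ B ∷ []) ℚ-ring ⟩
      D * D * (- ℕ→ℚ 4) + ℕ→ℚ 4 * D * (- 1ℚ) - D * D * (A - ℕ→ℚ 2 * B) ∎

theorem1 : (n : ℕ) → LHS n ≡ RHS n
theorem1 n =
  solve-for-sum (ℕ→ℚ n) (twoNm1 n) (ℕ→ℚ (4 ℕ.* n)) (LHS n) (Σ0to n (coeff n)) (recip-sum n) (H n) (H (2 ℕ.* n))
                (cong (_- 1ℚ) (ℕ→ℚ-* 2 n)) (ℕ→ℚ-* 4 n)
                (sum-coeff n) (harmonic-sum n) (sum-coeff-recip n)
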